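{- Let $H=(A,B,E)$ be a bipartite graph without isolated vertices, with $|A|=a$ and $|B|=b$. Then $t_{a,0}(H)=t_{0,b}(H)$.
   Context: A bipartite graph $H=(A,B,E)$ comes with designated sides $A,B$. For $m=|V(H)|$ and a permutation $\pi$ of $V(H)$ (a bijection to $[m]$), a vertex $i\in A$ is internally active if $\pi(i)>\pi(j)$ for all neighbours $j$ of $i$, and $j\in B$ is externally active if $\pi(j)>\pi(i)$ for all neighbours $i$ of $j$; $\mathrm{ia}(\pi),\mathrm{ea}(\pi)$ are their numbers, and $\widetilde{T}_H(x,y)=\frac{1}{m!}\sum_{\pi}x^{\mathrm{ia}(\pi)}y^{\mathrm{ea}(\pi)}=\sum_{i,j}t_{i,j}(H)x^iy^j$. -}

module Defs where

open import Data.Bool using (Bool; true; false; not; _∨_; if_then_else_)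
open import Data.Nat using (ℕ; zero; suc; _+_; _<ᵇ_; _!)
open import Data.Nat.Properties using (_!≢0)
open import Data.Fin using (Fin; toℕ; _↑ˡ_; _↑ʳ_)
open import Data.Fin.Properties using (_≟_)
open import Data.List using (List; []; _∷_; map; concatMap; length; filter; allFin)
open import Data.Nat using (_≡ᵇ_)
open import Data.Bool using (_∧_) renaming (_≟_ to _≟B_)
open import Data.Vec using (Vec; []; _∷_; lookup; toList)
open import Data.Integer using (+_)
open import Data.Rational using (ℚ; _/_)
open import Relation.Nullary.Decidable using (does)
open import Data.Product using (Σ; ∃; ∃-syntax)
open import Relation.Binary.PropositionalEquality using (_≡_)

BipGraph : ℕ → ℕ → Set
BipGraph a b = Fin a → Fin b → Bool

allB : ∀ {X : Set} → (X → Bool) → List X → Bool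
allB p []       = true
allB p (x ∷ xs) = p x ∧ allB p xs

NoIsolated : ∀ {a b} → BipGraph a b → Set
NoIsolated {a} {b} E = (∀ (i : Fin a) → ∃[ j ] E i j ≡ true) Data.Product.× (∀ (j : Fin b) → ∃[ i ] E i j ≡ true)

-- Vertex set V(H) = A ⊎ B identified with Fin (a + b): A-vertex i ↦ i, B-vertex j ↦ a + j.
vA : ∀ {a} b → Fin a → Fin (a + b)
vA b i = i ↑ˡ b

vB : ∀ a {b} → Fin b → Fin (a + b)
vB a j = a ↑ʳ j

allVecs : (k n : ℕ) → List (Vec (Fin n) k)
allVecs zero    n = [] ∷ []
allVecs (suc k) n = concatMap (λ x → map (x ∷_) (allVecs k n)) (allFin n)

isInjective : ∀ {k n} → Vec (Fin n) k → Bool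
isInjective {n = n} v = does (unique? (toList v))
  where open import Data.List.Relation.Unary.Unique.DecPropositional (_≟_ {n = n}) using (unique?)

-- All permutations π of V(H), i.e. bijections V(H) → [m] (here [m] = Fin m).
perms : (m : ℕ) → List (Vec (Fin m) m)
perms m = filter (λ v → isInjective v ≟B true) (allVecs m m)

countTrue : ∀ {X : Set} → (X → Bool) → List X → ℕ
countTrue p xs = length (filter (λ x → p x ≟B true) xs)

module _ {a b : ℕ} (E : BipGraph a b) (π : Vec (Fin (a + b)) (a + b)) where
  private
    pos : Fin (a + b) → ℕ
    pos v = toℕ (lookup π v)

  internallyActive : Fin a → Bool
  internallyActive i = allB (λ j → not (E i j) ∨ (pos (vB a j) <ᵇ pos (vA b i))) (allFin b)

  externallyActive : Fin b → Bool
  externallyActive j = allB (λ i → not (E i j) ∨ (pos (vA b i) <ᵇ pos (vB a j))) (allFin a)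

  ia : ℕ
  ia = countTrue internallyActive (allFin a)

  ea : ℕ
  ea = countTrue externallyActive (allFin b)

-- t_{i,j}(H) = (1/m!) · #{π : ia(π) = i, ea(π) = j}, the coefficient of x^i y^j in T̃_H.
tcoef : ∀ {a b} → BipGraph a b → ℕ → ℕ → ℚ
tcoef {a} {b} E i j =
  _/_ (+ countTrue (λ π → (ia E π ≡ᵇ i) ∧ (ea E π ≡ᵇ j)) (perms (a + b)))
    ((a + b) !) {{(a + b) !≢0}}

-- Reversing a permutation π (position k ↦ m − 1 − k) turns every edge that
-- descends from its A-end to its B-end into one that ascends, and conversely.
-- A vertex i ∈ A is internally active exactly when all its edges descend, so
-- ia(π) = a means that every edge descends; since no vertex of B is isolated,
-- this already forces ea(π) = 0. Symmetrically ia(π) = 0 and ea(π) = b means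
-- that every edge ascends. Reversal is a bijection on permutations, so both
-- sets of permutations have the same size.
module Submission where

open import Defs
open import Data.Bool using (Bool; true; false; not; _∨_; _∧_) renaming (_≟_ to _≟B_)
open import Data.Bool.Properties using (T-≡; ⇔→≡; ¬-not; not-¬)
open import Data.Fin using (Fin; toℕ; opposite; zero; suc)
open import Data.Fin.Permutation using (Permutation′; _⟨$⟩ʳ_; _⟨$⟩ˡ_; inverseˡ; reverse)
open import Data.Fin.Properties using (_≟_; opposite-prop; opposite-involutive; toℕ<n)
import Data.Integer as ℤ
open import Data.List using (List; []; _∷_; _++_; map; concatMap; length; filter; allFin; tabulate)
open import Data.List.Properties using (filter-++; length-++; filter-≐; filter-all; filter-none; filter-complete; filter-some; length-tabulate; map-tabulate; map-cong)
open import Data.List.Relation.Unary.All using (All; []; _∷_)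
import Data.List.Relation.Unary.All.Properties as All
import Data.List.Relation.Unary.Any.Properties as Any
open import Data.List.Relation.Unary.Unique.Propositional.Properties using (map⁺; map⁻)
open import Data.Nat using (ℕ; zero; suc; _+_; _<_; _<ᵇ_; _≡ᵇ_; _!; s≤s)
open import Data.Nat.ListAction using (sum)
open import Data.Nat.Properties using (<ᵇ⇒<; <⇒<ᵇ; ≡ᵇ⇒≡; ≡⇒≡ᵇ; <-asym; <-irrefl; ∸-monoʳ-<; _!≢0; +-0-commutativeMonoid)
open import Algebra.Properties.CommutativeMonoid.Sum +-0-commutativeMonoid using (∑-permute) renaming (sum to ∑)
open import Data.Product using (_×_; _,_; proj₁; proj₂; ∃-syntax)
open import Data.Rational using (_/_)
open import Data.Vec as Vec using (Vec; lookup; toList)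
open import Data.Vec.Properties using (lookup-map; toList-map)
open import Function using (_∘_; _⟨_⟩_; _⇔_; mk⇔; Equivalence)
import Function.Properties.Equivalence as ⇔
open import Relation.Nullary.Decidable using (does-⇔)
open import Relation.Binary.PropositionalEquality

open Equivalence

private
  variable
    X Y : Set

countTrue-++ : (p : X → Bool) (xs ys : List X) →
               countTrue p (xs ++ ys) ≡ countTrue p xs + countTrue p ys
countTrue-++ p xs ys =
  trans (cong length (filter-++ (λ x → p x ≟B true) xs ys)) (length-++ (filter _ xs))

countTrue-concatMap : (p : Y → Bool) (f : X → List Y) (xs : List X) →
                      countTrue p (concatMap f xs) ≡ sum (map (countTrue p ∘ f) xs)
countTrue-concatMap p f []       = refl
countTrue-concatMap p f (x ∷ xs) =
  trans (countTrue-++ p (f x) _) (cong (countTrue p (f x) +_) (countTrue-concatMap p f xs))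

countTrue-map : (p : Y → Bool) (f : X → Y) (xs : List X) →
                countTrue p (map f xs) ≡ countTrue (p ∘ f) xs
countTrue-map p f []       = refl
countTrue-map p f (x ∷ xs) with p (f x)
... | true  = cong suc (countTrue-map p f xs)
... | false = countTrue-map p f xs

countTrue-cong : {p q : X → Bool} → (∀ x → p x ≡ q x) → ∀ xs → countTrue p xs ≡ countTrue q xs
countTrue-cong p≗q xs =
  cong length (filter-≐ _ _ ((λ {x} → trans (sym (p≗q x))) , (λ {x} → trans (p≗q x))) xs)

countTrue-filter : (q p : X → Bool) (xs : List X) →
                   countTrue p (filter (λ x → q x ≟B true) xs) ≡ countTrue (λ x → q x ∧ p x) xs
countTrue-filter q p []       = refl
countTrue-filter q p (x ∷ xs) with q x
... | false = countTrue-filter q p xs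
... | true with p x
...   | true  = cong suc (countTrue-filter q p xs)
...   | false = countTrue-filter q p xs

module _ {n : ℕ} (p : Fin n → Bool) where

  countTrue-allFin≡n⇔ : countTrue p (allFin n) ≡ n ⇔ (∀ i → p i ≡ true)
  countTrue-allFin≡n⇔ = mk⇔
    (λ c≡n → All.tabulate⁻ (subst (All _)
      (filter-complete _ (trans c≡n (sym (length-tabulate (λ i → i)))))
      (All.all-filter _ (allFin n))))
    (λ all → trans (cong length (filter-all _ (All.tabulate⁺ all))) (length-tabulate (λ i → i)))

  countTrue-allFin≡0⇔ : countTrue p (allFin n) ≡ 0 ⇔ (∀ i → p i ≡ false)
  countTrue-allFin≡0⇔ = mk⇔
    (λ c≡0 i → ¬-not λ pi≡true →
      <-irrefl (sym c≡0) (filter-some (λ x → p x ≟B true) (Any.tabulate⁺ i pi≡true)))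
    (λ none → cong length (filter-none (λ x → p x ≟B true)
      (All.tabulate⁺ (not-¬ ∘ none))))

sum-tabulate : ∀ {n} (f : Fin n → ℕ) → sum (tabulate f) ≡ ∑ f
sum-tabulate {zero}  f = refl
sum-tabulate {suc n} f = cong (f zero +_) (sum-tabulate (f ∘ suc))

sum-map-allFin-permute : ∀ {n} (σ : Permutation′ n) (f : Fin n → ℕ) →
                         sum (map f (allFin n)) ≡ sum (map (f ∘ (σ ⟨$⟩ʳ_)) (allFin n))
sum-map-allFin-permute {n} σ f = begin
  sum (map f (allFin n))              ≡⟨ cong sum (map-tabulate (λ i → i) f) ⟩
  sum (tabulate f)                    ≡⟨ sum-tabulate f ⟩
  ∑ f                                 ≡⟨ ∑-permute f σ ⟩
  ∑ (f ∘ (σ ⟨$⟩ʳ_))                   ≡⟨ sum-tabulate (f ∘ (σ ⟨$⟩ʳ_)) ⟨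
  sum (tabulate (f ∘ (σ ⟨$⟩ʳ_)))      ≡⟨ cong sum (map-tabulate (λ i → i) (f ∘ (σ ⟨$⟩ʳ_))) ⟨
  sum (map (f ∘ (σ ⟨$⟩ʳ_)) (allFin n)) ∎
  where open ≡-Reasoning

countTrue-allVecs-suc : ∀ k n (p : Vec (Fin n) (suc k) → Bool) →
                        countTrue p (allVecs (suc k) n) ≡
                        sum (map (λ x → countTrue (p ∘ (x Vec.∷_)) (allVecs k n)) (allFin n))
countTrue-allVecs-suc k n p = trans (countTrue-concatMap p _ (allFin n))
  (cong sum (map-cong (λ x → countTrue-map p (x Vec.∷_) (allVecs k n)) (allFin n)))

countTrue-allVecs-permute : ∀ k {n} (σ : Permutation′ n) (p : Vec (Fin n) k → Bool) →
                            countTrue p (allVecs k n) ≡ countTrue (p ∘ Vec.map (σ ⟨$⟩ʳ_)) (allVecs k n)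
countTrue-allVecs-permute zero {n} σ p =
  countTrue-cong {p = p} {q = p ∘ Vec.map (σ ⟨$⟩ʳ_)} (λ { Vec.[] → refl }) (allVecs zero n)
countTrue-allVecs-permute (suc k) {n} σ p = begin
  countTrue p (allVecs (suc k) n)
    ≡⟨ countTrue-allVecs-suc k n p ⟩
  sum (map (λ x → countTrue (p ∘ (x Vec.∷_)) (allVecs k n)) (allFin n))
    ≡⟨ cong sum (map-cong (λ x → countTrue-allVecs-permute k σ (p ∘ (x Vec.∷_))) (allFin n)) ⟩
  sum (map (λ x → countTrue (λ v → p (x Vec.∷ Vec.map (σ ⟨$⟩ʳ_) v)) (allVecs k n)) (allFin n))
    ≡⟨ sum-map-allFin-permute σ _ ⟩
  sum (map (λ x → countTrue (p ∘ Vec.map (σ ⟨$⟩ʳ_) ∘ (x Vec.∷_)) (allVecs k n)) (allFin n))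
    ≡⟨ countTrue-allVecs-suc k n (p ∘ Vec.map (σ ⟨$⟩ʳ_)) ⟨
  countTrue (p ∘ Vec.map (σ ⟨$⟩ʳ_)) (allVecs (suc k) n) ∎
  where open ≡-Reasoning

⟨$⟩ʳ-injective : ∀ {n} (σ : Permutation′ n) {x y : Fin n} → σ ⟨$⟩ʳ x ≡ σ ⟨$⟩ʳ y → x ≡ y
⟨$⟩ʳ-injective σ σx≡σy =
  trans (sym (inverseˡ σ)) (trans (cong (σ ⟨$⟩ˡ_) σx≡σy) (inverseˡ σ))

isInjective-map : ∀ {k n} {f : Fin n → Fin n} → (∀ {x y} → f x ≡ f y → x ≡ y) →
                  (v : Vec (Fin n) k) → isInjective (Vec.map f v) ≡ isInjective v
isInjective-map {n = n} {f} f-injective v rewrite toList-map f v =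
  does-⇔ (mk⇔ map⁻ (map⁺ f-injective)) (unique? (map f (toList v))) (unique? (toList v))
  where open import Data.List.Relation.Unary.Unique.DecPropositional (_≟_ {n = n}) using (unique?)

countTrue-perms-permute : ∀ {m} (σ : Permutation′ m) (p : Vec (Fin m) m → Bool) →
                          countTrue p (perms m) ≡ countTrue (p ∘ Vec.map (σ ⟨$⟩ʳ_)) (perms m)
countTrue-perms-permute {m} σ p = begin
  countTrue p (perms m)
    ≡⟨ countTrue-filter isInjective p (allVecs m m) ⟩
  countTrue (λ v → isInjective v ∧ p v) (allVecs m m)
    ≡⟨ countTrue-allVecs-permute m σ _ ⟩
  countTrue (λ v → isInjective (σ* v) ∧ p (σ* v)) (allVecs m m)
    ≡⟨ countTrue-cong (λ v → cong (_∧ p (σ* v)) (isInjective-map (⟨$⟩ʳ-injective σ) v)) (allVecs m m) ⟩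
  countTrue (λ v → isInjective v ∧ p (σ* v)) (allVecs m m)
    ≡⟨ countTrue-filter isInjective (p ∘ σ*) (allVecs m m) ⟨
  countTrue (p ∘ σ*) (perms m) ∎
  where
    open ≡-Reasoning
    σ* : Vec (Fin m) m → Vec (Fin m) m
    σ* = Vec.map (σ ⟨$⟩ʳ_)

∧-true⇔ : ∀ {x y} → x ∧ y ≡ true ⇔ (x ≡ true × y ≡ true)
∧-true⇔ {true}  = mk⇔ (refl ,_) (λ (_ , y≡true) → y≡true)
∧-true⇔ {false} = mk⇔ (λ ()) (λ ())

allB-true⇔All : (p : X → Bool) (xs : List X) → allB p xs ≡ true ⇔ All (λ x → p x ≡ true) xs
allB-true⇔All p []       = mk⇔ (λ _ → []) (λ _ → refl)
allB-true⇔All p (x ∷ xs) = mk⇔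
  (λ e → let (px , rest) = to ∧-true⇔ e in px ∷ to (allB-true⇔All p xs) rest)
  (λ { (px ∷ all) → from ∧-true⇔ (px , from (allB-true⇔All p xs) all) })

not-∨-true⇔ : ∀ {x y} → not x ∨ y ≡ true ⇔ (x ≡ true → y ≡ true)
not-∨-true⇔ {true}  = mk⇔ (λ y≡true _ → y≡true) (λ f → f refl)
not-∨-true⇔ {false} = mk⇔ (λ _ ()) (λ _ → refl)

<ᵇ-true⇔ : ∀ {m n} → (m <ᵇ n) ≡ true ⇔ m < n
<ᵇ-true⇔ {m} {n} = ⇔.trans (⇔.sym T-≡) (mk⇔ (<ᵇ⇒< m n) <⇒<ᵇ)

≡ᵇ-true⇔ : ∀ {m n} → (m ≡ᵇ n) ≡ true ⇔ m ≡ n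
≡ᵇ-true⇔ {m} {n} = ⇔.trans (⇔.sym T-≡) (mk⇔ (≡ᵇ⇒≡ m n) (≡⇒≡ᵇ m n))

allB-not-∨-<ᵇ⇔ : ∀ {n} (e : Fin n → Bool) (f g : Fin n → ℕ) →
                 allB (λ k → not (e k) ∨ (f k <ᵇ g k)) (allFin n) ≡ true ⇔
                 (∀ k → e k ≡ true → f k < g k)
allB-not-∨-<ᵇ⇔ e f g = mk⇔
  (λ all k → to <ᵇ-true⇔ ∘ to not-∨-true⇔ (All.tabulate⁻ (to (allB-true⇔All _ _) all) k))
  (λ below → from (allB-true⇔All _ _)
    (All.tabulate⁺ λ k → from not-∨-true⇔ (from <ᵇ-true⇔ ∘ below k)))

opposite-< : ∀ {n} {i j : Fin n} → toℕ i < toℕ j → toℕ (opposite j) < toℕ (opposite i)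
opposite-< {i = i} {j} i<j rewrite opposite-prop i | opposite-prop j = ∸-monoʳ-< (s≤s i<j) (toℕ<n j)

opposite-<⇔ : ∀ {n} {i j : Fin n} → toℕ (opposite j) < toℕ (opposite i) ⇔ toℕ i < toℕ j
opposite-<⇔ {i = i} {j} = mk⇔
  (subst₂ (λ x y → toℕ x < toℕ y) (opposite-involutive i) (opposite-involutive j) ∘ opposite-<)
  opposite-<

pos : ∀ {m} → Vec (Fin m) m → Fin m → ℕ
pos π v = toℕ (lookup π v)

pos-reverse : ∀ {m} (π : Vec (Fin m) m) (v : Fin m) →
              pos (Vec.map opposite π) v ≡ toℕ (opposite (lookup π v))
pos-reverse π v = cong toℕ (lookup-map v opposite π)

module _ {a b : ℕ} (E : BipGraph a b) where

  private
    Perm : Set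
    Perm = Vec (Fin (a + b)) (a + b)

  Descending Ascending : Perm → Set
  Descending π = ∀ i j → E i j ≡ true → pos π (vB a j) < pos π (vA b i)
  Ascending  π = ∀ i j → E i j ≡ true → pos π (vA b i) < pos π (vB a j)

  hasActivities : ℕ → ℕ → Perm → Bool
  hasActivities i j π = (ia E π ≡ᵇ i) ∧ (ea E π ≡ᵇ j)

  module _ (π : Perm) where

    internallyActive⇔ : ∀ i → internallyActive E π i ≡ true ⇔
                        (∀ j → E i j ≡ true → pos π (vB a j) < pos π (vA b i))
    internallyActive⇔ i = allB-not-∨-<ᵇ⇔ _ _ _

    externallyActive⇔ : ∀ j → externallyActive E π j ≡ true ⇔
                        (∀ i → E i j ≡ true → pos π (vA b i) < pos π (vB a j))
    externallyActive⇔ j = allB-not-∨-<ᵇ⇔ _ _ _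

    ia≡a⇔Descending : ia E π ≡ a ⇔ Descending π
    ia≡a⇔Descending = mk⇔
      (λ ia≡a i → to (internallyActive⇔ i) (to (countTrue-allFin≡n⇔ _) ia≡a i))
      (λ desc → from (countTrue-allFin≡n⇔ _) (λ i → from (internallyActive⇔ i) (desc i)))

    ea≡b⇔Ascending : ea E π ≡ b ⇔ Ascending π
    ea≡b⇔Ascending = mk⇔
      (λ ea≡b i j → to (externallyActive⇔ j) (to (countTrue-allFin≡n⇔ _) ea≡b j) i)
      (λ asc → from (countTrue-allFin≡n⇔ _) (λ j → from (externallyActive⇔ j) (λ i → asc i j)))

    Descending⇒ea≡0 : (∀ j → ∃[ i ] E i j ≡ true) → Descending π → ea E π ≡ 0
    Descending⇒ea≡0 hasNeighbour desc = from (countTrue-allFin≡0⇔ _) λ j → ¬-not λ active →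
      let (i , eij) = hasNeighbour j in
      <-asym (desc i j eij) (to (externallyActive⇔ j) active i eij)

    Ascending⇒ia≡0 : (∀ i → ∃[ j ] E i j ≡ true) → Ascending π → ia E π ≡ 0
    Ascending⇒ia≡0 hasNeighbour asc = from (countTrue-allFin≡0⇔ _) λ i → ¬-not λ active →
      let (j , eij) = hasNeighbour i in
      <-asym (asc i j eij) (to (internallyActive⇔ i) active j eij)

    hasActivities⇔ : ∀ k l → hasActivities k l π ≡ true ⇔ (ia E π ≡ k × ea E π ≡ l)
    hasActivities⇔ k l = mk⇔
      (λ e → let (ia≡k , ea≡l) = to ∧-true⇔ e in to ≡ᵇ-true⇔ ia≡k , to ≡ᵇ-true⇔ ea≡l)
      (λ (ia≡k , ea≡l) → from ∧-true⇔ (from ≡ᵇ-true⇔ ia≡k , from ≡ᵇ-true⇔ ea≡l))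

    Descending-reverse⇔Ascending : Descending (Vec.map opposite π) ⇔ Ascending π
    Descending-reverse⇔Ascending = mk⇔
      (λ desc i j eij → to opposite-<⇔
        (subst₂ _<_ (pos-reverse π (vB a j)) (pos-reverse π (vA b i)) (desc i j eij)))
      (λ asc i j eij → subst₂ _<_ (sym (pos-reverse π (vB a j))) (sym (pos-reverse π (vA b i)))
        (from opposite-<⇔ (asc i j eij)))

  module _ (noIsolated : NoIsolated E) (π : Perm) where

    hasActivities-a0⇔Descending : hasActivities a 0 π ≡ true ⇔ Descending π
    hasActivities-a0⇔Descending = mk⇔
      (λ e → to (ia≡a⇔Descending π) (proj₁ (to (hasActivities⇔ π a 0) e)))
      (λ desc → from (hasActivities⇔ π a 0)
        (from (ia≡a⇔Descending π) desc , Descending⇒ea≡0 π (proj₂ noIsolated) desc))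

    hasActivities-0b⇔Ascending : hasActivities 0 b π ≡ true ⇔ Ascending π
    hasActivities-0b⇔Ascending = mk⇔
      (λ e → to (ea≡b⇔Ascending π) (proj₂ (to (hasActivities⇔ π 0 b) e)))
      (λ asc → from (hasActivities⇔ π 0 b)
        (Ascending⇒ia≡0 π (proj₁ noIsolated) asc , from (ea≡b⇔Ascending π) asc))

  hasActivities-a0-reverse : NoIsolated E → ∀ π →
                             hasActivities a 0 (Vec.map opposite π) ≡ hasActivities 0 b π
  hasActivities-a0-reverse noIsolated π = ⇔→≡ (
    hasActivities-a0⇔Descending noIsolated (Vec.map opposite π) ⟨ ⇔.trans ⟩
    Descending-reverse⇔Ascending π                               ⟨ ⇔.trans ⟩
    ⇔.sym (hasActivities-0b⇔Ascending noIsolated π))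

mainTheorem14 : (a b : ℕ) (E : BipGraph a b) → NoIsolated E → tcoef E a 0 ≡ tcoef E 0 b
mainTheorem14 a b E noIsolated = cong (λ c → (ℤ.+ c / (a + b) !) {{(a + b) !≢0}}) (begin
  countTrue (hasActivities E a 0) (perms (a + b))
    ≡⟨ countTrue-perms-permute reverse (hasActivities E a 0) ⟩
  countTrue (hasActivities E a 0 ∘ Vec.map opposite) (perms (a + b))
    ≡⟨ countTrue-cong (hasActivities-a0-reverse E noIsolated) (perms (a + b)) ⟩
  countTrue (hasActivities E 0 b) (perms (a + b)) ∎)
  where open ≡-Reasoning
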